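{- (1) If $I_{d}\in\mathcal{C}$, then $(id)$ can be permuted above $(s_{\exists}^{1})$; and (2) if $D_{d}\in\mathcal{C}$, then $(dd)$ can be permuted above $(s_{\exists}^{1})$.
   Context: $\mathcal{C}$ is a set of frame conditions for first-order modal logic drawn from: seriality $S$; general path conditions $G(n,k)$ (if $wR^{n}u$ and $wR^{k}v$ then $uRv$); increasing domains $I_{d}$ ($wRu$ implies $D(w)\subseteq D(u)$); decreasing domains $D_{d}$ ($wRu$ implies $D(u)\subseteq D(w)$); constant domains $C_{d}$ (treated as both); non-empty domains $N_{d}$. Let $\mathcal{G}$ be the set of $G(n,k)\in\mathcal{C}$. Strings over $\{\Diamond,\Diamond^{ -1}\}$ ($\Diamond$ forward move, $\Diamond^{ -1}$ backward move, the "black diamond"). For a semi-Thue system $\mathrm{S}$ (productions $a\longrightarrow s$), $L_{\mathrm{S}}(a)$ is the set of strings derivable from $a$ by repeated rewriting. $\mathrm{S}(\mathcal{G})$ contains $\Diamond\longrightarrow(\Diamond^{ -1})^{n}\Diamond^{k}$ and $\Diamond^{ -1}\longrightarrow(\Diamond^{ -1})^{k}\Diamond^{n}$ for each $G(n,k)\in\mathcal{G}$; $\mathrm{S4}=\{\Diamond\longrightarrow\varepsilon,\Diamond^{ -1}\longrightarrow\varepsilon,\Diamond\longrightarrow\Diamond\Diamond,\Diamond^{ -1}\longrightarrow\Diamond^{ -1}\Diamond^{ -1}\}$; $\mathrm{S5}=\{\Diamond\longrightarrow\varepsilon,\Diamond^{ -1}\longrightarrow\varepsilon,\Diamond\longrightarrow\Diamond^{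 -1}\Diamond,\Diamond^{ -1}\longrightarrow\Diamond^{ -1}\Diamond\}$. Labeled sequents $\mathcal{R},\Gamma\vdash\Delta$ ($\mathcal{R}$: relational atoms $wRu$ and domain atoms $x\in D(w)$; labeled formulae $w:\phi$). Propagation graph of $\mathcal{R}$: vertices labels, edges $(w,\Diamond,u)$ and $(u,\Diamond^{ -1},w)$ for each $wRu\in\mathcal{R}$; propagation paths follow edges, with string the sequence of characters ($\varepsilon$ for the empty path). $y$ is $(\mathrm{S},a)$-available for $w$ iff for some $u$, $y\in D(u)\in\mathcal{R}$ and some propagation path from $w$ to $u$ has string in $L_{\mathrm{S}}(a)$. Relational rules: $(id)$: from $\mathcal{R},wRu,x\in D(w),x\in D(u),\Gamma\vdash\Delta$ infer $\mathcal{R},wRu,x\in D(w),\Gamma\vdash\Delta$; $(dd)$: from $\mathcal{R},wRu,x\in D(w),x\in D(u),\Gamma\vdash\Delta$ infer $\mathcal{R},wRu,x\in D(u),\Gamma\vdash\Delta$. Reachability rule $(s_{\exists}^{1})$: from $\mathcal{R},\Gamma\vdash w:\phi[y/x],w:\exists x\phi,\Delta$ infer $\mathcal{R},\Gamma\vdash w:\exists x\phi,\Delta$, provided: if $I_d,D_d\in\mathcal{C}$, $y$ is $(\mathrm{S5},\Diamond)$-available for $w$; if $I_d\in\mathcal{C}$, $D_d\notin\mathcal{C}$, $y$ is $(\mathrm{S4}\cup\mathrm{S}(\mathcal{G}),\Diamond^{ -1})$-available for $w$; if $D_d\in\mathcal{C}$, $I_d\notin\mathcal{C}$, $y$ is $(\mathrm{S4}\cup\mathrm{S}(\mathcal{G}),\Diamond)$-available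 for $w$; if neither, $y\in D(w)\in\mathcal{R}$. -}

module Defs where

open import Data.Nat using (ℕ; _≟_)
open import Data.List using (List; []; _∷_; [_]; _++_)
open import Data.List.Membership.Propositional using (_∈_)
open import Data.List.Relation.Binary.Permutation.Propositional using (_↭_)
open import Data.Product using (Σ; _×_; _,_; ∃; ∃-syntax)
open import Data.Sum using (_⊎_)
open import Relation.Nullary using (¬_; yes; no)
open import Relation.Binary.PropositionalEquality using (_≡_)

data FrameCond : Set where
  Ser  : FrameCond
  G    : ℕ → ℕ → FrameCond
  Incr : FrameCond
  Decr : FrameCond
  Cnst : FrameCond                 -- C_d (treated as both I_d and D_d)
  NonE : FrameCond

FrameConds : Set
FrameConds = List FrameCond

HasI : FrameConds → Set
HasI C = Incr ∈ C ⊎ Cnst ∈ C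

HasD : FrameConds → Set
HasD C = Decr ∈ C ⊎ Cnst ∈ C

data Char : Set where
  ◇ : Char
  ◆ : Char   -- backward move (black diamond, ◇⁻¹)

Str : Set
Str = List Char

-- A semi-Thue system is a (possibly infinite) set of productions a ⟶ s.
ThueSystem : Set₁
ThueSystem = Char → Str → Set

rep : ℕ → Char → Str
rep ℕ.zero    c = []
rep (ℕ.suc n) c = c ∷ rep n c

data SG (C : FrameConds) : ThueSystem where
  fwd : ∀ {n k} → G n k ∈ C → SG C ◇ (rep n ◆ ++ rep k ◇)
  bwd : ∀ {n k} → G n k ∈ C → SG C ◆ (rep k ◆ ++ rep n ◇)

data S4 : ThueSystem where
  s4-1 : S4 ◇ []
  s4-2 : S4 ◆ []
  s4-3 : S4 ◇ (◇ ∷ ◇ ∷ [])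
  s4-4 : S4 ◆ (◆ ∷ ◆ ∷ [])

data S5 : ThueSystem where
  s5-1 : S5 ◇ []
  s5-2 : S5 ◆ []
  s5-3 : S5 ◇ (◆ ∷ ◇ ∷ [])
  s5-4 : S5 ◆ (◆ ∷ ◇ ∷ [])

_∪S_ : ThueSystem → ThueSystem → ThueSystem
(S ∪S T) a s = S a s ⊎ T a s

data Rewrite (S : ThueSystem) : Str → Str → Set where
  rw : ∀ s₁ s₂ {a t} → S a t → Rewrite S (s₁ ++ [ a ] ++ s₂) (s₁ ++ t ++ s₂)

data Rewrites (S : ThueSystem) : Str → Str → Set where
  done : ∀ {s} → Rewrites S s s
  step : ∀ {s t u} → Rewrite S s t → Rewrites S t u → Rewrites S s u

L : ThueSystem → Char → Str → Set
L S a s = Rewrites S [ a ] s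

Label : Set
Label = ℕ

Var : Set
Var = ℕ

data Formula : Set where
  atom : ℕ → List Var → Formula
  ⊥f   : Formula
  ¬f   : Formula → Formula
  _∧f_ : Formula → Formula → Formula
  _∨f_ : Formula → Formula → Formula
  _⇒f_ : Formula → Formula → Formula
  □f   : Formula → Formula
  ◇f   : Formula → Formula
  ∀f   : Var → Formula → Formula
  ∃f   : Var → Formula → Formula

substVar : Var → Var → Var → Var
substVar y x z with z ≟ x
... | yes _ = y
... | no  _ = z

substVars : Var → Var → List Var → List Var
substVars y x []       = []
substVars y x (z ∷ zs) = substVar y x z ∷ substVars y x zs

_[_/_] : Formula → Var → Var → Formula
atom p zs [ y / x ] = atom p (substVars y x zs)
⊥f        [ y / x ] = ⊥f
¬f φ      [ y / x ] = ¬f (φ [ y / x ])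
(φ ∧f ψ)  [ y / x ] = (φ [ y / x ]) ∧f (ψ [ y / x ])
(φ ∨f ψ)  [ y / x ] = (φ [ y / x ]) ∨f (ψ [ y / x ])
(φ ⇒f ψ)  [ y / x ] = (φ [ y / x ]) ⇒f (ψ [ y / x ])
□f φ      [ y / x ] = □f (φ [ y / x ])
◇f φ      [ y / x ] = ◇f (φ [ y / x ])
∀f z φ    [ y / x ] with z ≟ x
... | yes _ = ∀f z φ
... | no  _ = ∀f z (φ [ y / x ])
∃f z φ    [ y / x ] with z ≟ x
... | yes _ = ∃f z φ
... | no  _ = ∃f z (φ [ y / x ])

data RAtom : Set where
  rel : Label → Label → RAtom
  dom : Var → Label → RAtom

record LFormula : Set where
  constructor _∶_
  field
    lab : Label
    fml : Formula

record Sequent : Set where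
  constructor _⨾_⊢_
  field
    rels : List RAtom
    ante : List LFormula
    succ : List LFormula

-- sequents are built from multisets: equality up to permutation
_≈S_ : Sequent → Sequent → Set
(R ⨾ Γ ⊢ Δ) ≈S (R' ⨾ Γ' ⊢ Δ') = (R ↭ R') × (Γ ↭ Γ') × (Δ ↭ Δ')

data Edge (R : List RAtom) : Label → Char → Label → Set where
  fwdE : ∀ {w u} → rel w u ∈ R → Edge R w ◇ u
  bwdE : ∀ {w u} → rel w u ∈ R → Edge R u ◆ w

data Path (R : List RAtom) : Label → Str → Label → Set where
  ε    : ∀ {w} → Path R w [] w
  _▸_  : ∀ {w v u c s} → Edge R w c v → Path R v s u → Path R w (c ∷ s) u

Available : ThueSystem → Char → List RAtom → Var → Label → Set
Available S a R y w =
  Σ Label λ u → Σ Str λ s → (dom y u ∈ R) × Path R w s u × L S a s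

SideCond : FrameConds → List RAtom → Var → Label → Set
SideCond C R y w =
    (HasI C → HasD C → Available S5 ◇ R y w)
  × (HasI C → ¬ HasD C → Available (S4 ∪S SG C) ◆ R y w)
  × (¬ HasI C → HasD C → Available (S4 ∪S SG C) ◇ R y w)
  × (¬ HasI C → ¬ HasD C → dom y w ∈ R)

-- Rule instances (premise, conclusion), up to multiset equality

Rule : Set₁
Rule = Sequent → Sequent → Set

IdRule : Rule
IdRule P Q = Σ (List RAtom) λ R → Σ (List LFormula) λ Γ → Σ (List LFormula) λ Δ →
  Σ Label λ w → Σ Label λ u → Σ Var λ x →
    (P ≈S ((rel w u ∷ dom x w ∷ dom x u ∷ R) ⨾ Γ ⊢ Δ))
  × (Q ≈S ((rel w u ∷ dom x w ∷ R) ⨾ Γ ⊢ Δ))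

DdRule : Rule
DdRule P Q = Σ (List RAtom) λ R → Σ (List LFormula) λ Γ → Σ (List LFormula) λ Δ →
  Σ Label λ w → Σ Label λ u → Σ Var λ x →
    (P ≈S ((rel w u ∷ dom x w ∷ dom x u ∷ R) ⨾ Γ ⊢ Δ))
  × (Q ≈S ((rel w u ∷ dom x u ∷ R) ⨾ Γ ⊢ Δ))

SExists1 : FrameConds → Rule
SExists1 C P Q = Σ (List RAtom) λ R → Σ (List LFormula) λ Γ → Σ (List LFormula) λ Δ →
  Σ Label λ w → Σ Var λ x → Σ Formula λ φ → Σ Var λ y →
    (P ≈S (R ⨾ Γ ⊢ ((w ∶ (φ [ y / x ])) ∷ (w ∶ ∃f x φ) ∷ Δ)))
  × (Q ≈S (R ⨾ Γ ⊢ ((w ∶ ∃f x φ) ∷ Δ)))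
  × SideCond C R y w

PermutesAbove : Rule → Rule → Set
PermutesAbove r s = ∀ S₁ S₂ S₃ → s S₁ S₂ → r S₂ S₃ →
  Σ Sequent λ S₂' → r S₁ S₂' × s S₂' S₃

-- Applying (id) (resp. (dd)) first deletes the domain atom x ∈ D(u) (resp. x ∈ D(w))
-- from the relational context seen by (s∃¹), but keeps x in the domain of a world one
-- backward (resp. forward) step away along w R u.  Any propagation path witnessing the
-- availability of the lost atom can therefore be extended by one ◆ (resp. ◇) edge.
-- The strings so obtained remain in the relevant language: under I_d the side condition
-- uses L_{S4 ∪ S(𝒢)}(◆) (or L_{S5}(◇), which is every string), and S4 contains ◆ ⟶ ◆◆;
-- dually under D_d with ◇ ⟶ ◇◇.
module Submission where

open import Defs
open import Data.Product using (Σ; _×_; _,_; proj₁; proj₂)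
open import Data.Sum using (_⊎_; inj₁; inj₂)
open import Data.Empty using (⊥-elim)
open import Data.List using (List; []; _∷_; [_]; _++_)
open import Data.List.Properties using (++-assoc; ++-identityʳ)
open import Data.List.Relation.Unary.Any using (here; there)
open import Data.List.Membership.Propositional using (_∈_)
open import Data.List.Relation.Binary.Permutation.Propositional using (_↭_; ↭-sym; ↭-trans; ↭-refl)
open import Data.List.Relation.Binary.Permutation.Propositional.Properties using (∈-resp-↭)
open import Relation.Binary.PropositionalEquality using (refl; subst)

rewrites-trans : ∀ {S s t u} → Rewrites S s t → Rewrites S t u → Rewrites S s u
rewrites-trans done q = q
rewrites-trans (step r p) q = step r (rewrites-trans p q)

rewrite-++ʳ : ∀ {S s t} r → Rewrite S s t → Rewrite S (s ++ r) (t ++ r)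
rewrite-++ʳ r (rw s₁ s₂ {a} {t} p)
  rewrite ++-assoc s₁ (a ∷ s₂) r | ++-assoc s₁ (t ++ s₂) r | ++-assoc t s₂ r
  = rw s₁ (s₂ ++ r) p

rewrites-++ʳ : ∀ {S s t} r → Rewrites S s t → Rewrites S (s ++ r) (t ++ r)
rewrites-++ʳ r done = done
rewrites-++ʳ r (step p q) = step (rewrite-++ʳ r p) (rewrites-++ʳ r q)

rewrites-∷ : ∀ {S s t} c → Rewrites S s t → Rewrites S (c ∷ s) (c ∷ t)
rewrites-∷ c done = done
rewrites-∷ c (step (rw s₁ s₂ p) q) = step (rw (c ∷ s₁) s₂ p) (rewrites-∷ c q)

AppendClosed : ThueSystem → Char → Char → Set
AppendClosed S a c = ∀ {s} → L S a s → L S a (s ++ [ c ])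

appendClosed-self : ∀ {S a} → S a (a ∷ a ∷ []) → AppendClosed S a a
appendClosed-self {a = a} a⟶aa l = step (rw [] [] a⟶aa) (rewrites-++ʳ [ a ] l)

-- ◇ ⟶ ◆◇ and ◆ ⟶ ◆◇ let any character be prepended to the trailing ◇.
S5-prepend : ∀ c → Rewrites S5 [ ◇ ] (c ∷ [ ◇ ])
S5-prepend ◆ = step (rw [] [] s5-3) done
S5-prepend ◇ = step (rw [] [] s5-3) (step (rw [] [ ◇ ] s5-4) (step (rw [] (◇ ∷ ◇ ∷ []) s5-2) done))

S5-◇-prefix : ∀ t → Rewrites S5 [ ◇ ] (t ++ [ ◇ ])
S5-◇-prefix [] = done
S5-◇-prefix (c ∷ t) = rewrites-trans (S5-prepend c) (rewrites-∷ c (S5-◇-prefix t))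

L-S5-◇-universal : ∀ t → L S5 ◇ t
L-S5-◇-universal t = rewrites-trans (S5-◇-prefix t)
  (step (subst (Rewrite S5 (t ++ [ ◇ ])) (++-identityʳ t) (rw t [] s5-1)) done)

appendClosed-S5 : ∀ c → AppendClosed S5 ◇ c
appendClosed-S5 c {s} _ = L-S5-◇-universal (s ++ [ c ])

path-mono : ∀ {R R' w s u} → (∀ {v v'} → rel v v' ∈ R → rel v v' ∈ R') →
            Path R w s u → Path R' w s u
path-mono sub ε = ε
path-mono sub (fwdE m ▸ p) = fwdE (sub m) ▸ path-mono sub p
path-mono sub (bwdE m ▸ p) = bwdE (sub m) ▸ path-mono sub p

path-snoc : ∀ {R w s u c v} → Path R w s u → Edge R u c v → Path R w (s ++ [ c ]) v
path-snoc ε e = e ▸ ε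
path-snoc (e' ▸ p) e = e' ▸ path-snoc p e

DomainWithin : Char → List RAtom → Var → Label → Set
DomainWithin c R' y u = dom y u ∈ R' ⊎ Σ Label λ v → Edge R' u c v × dom y v ∈ R'

record Covers (c : Char) (R R' : List RAtom) : Set where
  field
    rel-⊆ : ∀ {v v'} → rel v v' ∈ R → rel v v' ∈ R'
    dom-⊆ : ∀ {y u} → dom y u ∈ R → DomainWithin c R' y u
open Covers

covers-resp-↭ : ∀ {c R₁ R₂ R'} → R₁ ↭ R₂ → Covers c R₂ R' → Covers c R₁ R'
covers-resp-↭ R₁↭R₂ cov = record
  { rel-⊆ = λ m → rel-⊆ cov (∈-resp-↭ R₁↭R₂ m)
  ; dom-⊆ = λ m → dom-⊆ cov (∈-resp-↭ R₁↭R₂ m)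
  }

available-cover : ∀ {S a c R R' y w} → AppendClosed S a c → Covers c R R' →
                  Available S a R y w → Available S a R' y w
available-cover closed cov (u , s , d , p , l) with dom-⊆ cov d
... | inj₁ d' = u , s , d' , path-mono (rel-⊆ cov) p , l
... | inj₂ (v , e , d') = v , s ++ _ , d' , path-snoc (path-mono (rel-⊆ cov) p) e , closed l

bothDomains : Label → Label → Var → List RAtom → List RAtom
bothDomains w u x R = rel w u ∷ dom x w ∷ dom x u ∷ R

covers-id : ∀ w u x R → Covers ◆ (bothDomains w u x R) (rel w u ∷ dom x w ∷ R)
covers-id w u x R = record { rel-⊆ = rels ; dom-⊆ = doms }
  where
  rels : ∀ {v v'} → rel v v' ∈ bothDomains w u x R → rel v v' ∈ (rel w u ∷ dom x w ∷ R)
  rels (here refl) = here refl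
  rels (there (there (there m))) = there (there m)
  doms : ∀ {y v} → dom y v ∈ bothDomains w u x R → DomainWithin ◆ (rel w u ∷ dom x w ∷ R) y v
  doms (there (here refl)) = inj₁ (there (here refl))
  doms (there (there (here refl))) = inj₂ (w , bwdE (here refl) , there (here refl))
  doms (there (there (there m))) = inj₁ (there (there m))

covers-dd : ∀ w u x R → Covers ◇ (bothDomains w u x R) (rel w u ∷ dom x u ∷ R)
covers-dd w u x R = record { rel-⊆ = rels ; dom-⊆ = doms }
  where
  rels : ∀ {v v'} → rel v v' ∈ bothDomains w u x R → rel v v' ∈ (rel w u ∷ dom x u ∷ R)
  rels (here refl) = here refl
  rels (there (there (there m))) = there (there m)
  doms : ∀ {y v} → dom y v ∈ bothDomains w u x R → DomainWithin ◇ (rel w u ∷ dom x u ∷ R) y v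
  doms (there (here refl)) = inj₂ (u , fwdE (here refl) , there (here refl))
  doms (there (there (here refl))) = inj₁ (there (here refl))
  doms (there (there (there m))) = inj₁ (there (there m))

sideCond-cover-◆ : ∀ {C R R' y w} → HasI C → Covers ◆ R R' → SideCond C R y w → SideCond C R' y w
sideCond-cover-◆ hI cov (s5 , s4 , _ , _) =
    (λ hi hd → available-cover (appendClosed-S5 ◆) cov (s5 hi hd))
  , (λ hi ¬hd → available-cover (appendClosed-self (inj₁ s4-4)) cov (s4 hi ¬hd))
  , (λ ¬hi _ → ⊥-elim (¬hi hI))
  , (λ ¬hi _ → ⊥-elim (¬hi hI))

sideCond-cover-◇ : ∀ {C R R' y w} → HasD C → Covers ◇ R R' → SideCond C R y w → SideCond C R' y w
sideCond-cover-◇ hD cov (s5 , _ , s4 , _) =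
    (λ hi hd → available-cover (appendClosed-S5 ◇) cov (s5 hi hd))
  , (λ _ ¬hd → ⊥-elim (¬hd hD))
  , (λ ¬hi hd → available-cover (appendClosed-self (inj₁ s4-3)) cov (s4 ¬hi hd))
  , (λ _ ¬hd → ⊥-elim (¬hd hD))

≈S-refl : ∀ {S} → S ≈S S
≈S-refl = ↭-refl , ↭-refl , ↭-refl

≈S-sym : ∀ {S S'} → S ≈S S' → S' ≈S S
≈S-sym (r , g , d) = ↭-sym r , ↭-sym g , ↭-sym d

≈S-trans : ∀ {S S' S''} → S ≈S S' → S' ≈S S'' → S ≈S S''
≈S-trans (r , g , d) (r' , g' , d') = ↭-trans r r' , ↭-trans g g' , ↭-trans d d'

RelationalRule : (Label → Label → Var → List RAtom → List RAtom) →
                 (Label → Label → Var → List RAtom → List RAtom) → Rule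
RelationalRule prem concl P Q = Σ (List RAtom) λ R → Σ (List LFormula) λ Γ → Σ (List LFormula) λ Δ →
  Σ Label λ w → Σ Label λ u → Σ Var λ x →
    (P ≈S (prem w u x R ⨾ Γ ⊢ Δ)) × (Q ≈S (concl w u x R ⨾ Γ ⊢ Δ))

relationalRule-permutesAbove-sExists1 :
  ∀ {C c} (prem concl : Label → Label → Var → List RAtom → List RAtom) →
  (∀ w u x R → Covers c (prem w u x R) (concl w u x R)) →
  (∀ {R R' y w} → Covers c R R' → SideCond C R y w → SideCond C R' y w) →
  PermutesAbove (RelationalRule prem concl) (SExists1 C)
relationalRule-permutesAbove-sExists1 prem concl cover transport S₁ S₂ S₃
  (R , Γ , Δ , w , x , φ , y , S₁≈ , S₂≈ , sc)
  (R₀ , Γ₀ , Δ₀ , a , b , z , S₂≈′ , S₃≈) =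
    (concl a b z R₀ ⨾ Γ ⊢ Δ⁺)
  , (R₀ , Γ , Δ⁺ , a , b , z , ≈S-trans S₁≈ (R↭ , ↭-refl , ↭-refl) , ≈S-refl)
  , (concl a b z R₀ , Γ , Δ , w , x , φ , y , ≈S-refl
    , ≈S-trans S₃≈ (↭-refl , ↭-sym Γ↭ , ↭-sym Δ↭)
    , transport (covers-resp-↭ R↭ (cover a b z R₀)) sc)
  where
  Δ⁺ : List LFormula
  Δ⁺ = (w ∶ (φ [ y / x ])) ∷ (w ∶ ∃f x φ) ∷ Δ
  two-views : (R ⨾ Γ ⊢ ((w ∶ ∃f x φ) ∷ Δ)) ≈S (prem a b z R₀ ⨾ Γ₀ ⊢ Δ₀)
  two-views = ≈S-trans (≈S-sym S₂≈) S₂≈′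
  R↭ : R ↭ prem a b z R₀
  R↭ = proj₁ two-views
  Γ↭ : Γ ↭ Γ₀
  Γ↭ = proj₁ (proj₂ two-views)
  Δ↭ : ((w ∶ ∃f x φ) ∷ Δ) ↭ Δ₀
  Δ↭ = proj₂ (proj₂ two-views)

mainTheorem3 : (C : FrameConds) →
    (HasI C → PermutesAbove IdRule (SExists1 C))
    × (HasD C → PermutesAbove DdRule (SExists1 C))
mainTheorem3 C =
    (λ hI → relationalRule-permutesAbove-sExists1
              bothDomains (λ w u x R → rel w u ∷ dom x w ∷ R)
              covers-id (sideCond-cover-◆ hI))
  , (λ hD → relationalRule-permutesAbove-sExists1
              bothDomains (λ w u x R → rel w u ∷ dom x u ∷ R)
              covers-dd (sideCond-cover-◇ hD))
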